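{- Let $q$ be a positive integer and let $H$ be a skew type Hadamard matrix of order $q+1$ of the form $H=\begin{pmatrix}1&\mathbf 1^\top\\-\mathbf 1& I_q+Q\end{pmatrix}$, where $\mathbf 1$ is the all-ones column vector of length $q$ and $Q$ is a $q\times q$ matrix. Let $C=H-I_{q+1}$ and define the $q(q+1)\times q(q+1)$ matrix $M=-I_{q+1}\otimes J_q+C\otimes (I_q+Q)$. Then $M$ is a balancedly splittable Hadamard matrix of order $q(q+1)$ with parameters $(q(q+1),q,q,-1)$.
   Context: A Hadamard matrix of order $n$ is an $n\times n$ $\{1,-1\}$-matrix $H$ with $HH^\top=nI_n$; it is of skew type if $H+H^\top=2I_n$. $J_n$ is the all-ones matrix and $\otimes$ is the Kronecker product. A Hadamard matrix of order $n$ is balancedly splittable with parameters $(n,\ell,a,b)$ if, after permuting its rows, $H=\begin{pmatrix}H_1\\H_2\end{pmatrix}$ with $H_1$ an $\ell\times n$ matrix such that $H_1^\top H_1=\ell I_n+aA+b(J_n-A-I_n)$ for a symmetric $(0,1)$-matrix $A$ with zero diagonal. -}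

module Defs where

open import Data.Nat using (ℕ; zero; suc; _≤_) renaming (_*_ to _*ℕ_)
open import Data.Fin using (Fin; zero; suc; inject≤; quotient; remainder)
open import Data.Fin.Permutation using (Permutation′; _⟨$⟩ʳ_)
open import Data.Integer using (ℤ; +_; -_; _+_; _-_; _*_; 0ℤ; 1ℤ; -1ℤ)
open import Data.Product using (Σ; _×_; _,_; ∃)
open import Data.Sum using (_⊎_)
open import Relation.Binary.PropositionalEquality using (_≡_)
open import Relation.Nullary using (Dec; yes; no)
open import Data.Fin using (_≟_)

Matrix : ℕ → ℕ → Set
Matrix m n = Fin m → Fin n → ℤ

sumFin : ∀ {n} → (Fin n → ℤ) → ℤ
sumFin {zero}  f = 0ℤ
sumFin {suc n} f = f zero + sumFin (λ i → f (suc i))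

_≐_ : ∀ {m n} → Matrix m n → Matrix m n → Set
A ≐ B = ∀ i j → A i j ≡ B i j

_·_ : ∀ {m n p} → Matrix m n → Matrix n p → Matrix m p
(A · B) i k = sumFin (λ j → A i j * B j k)

_ᵀ : ∀ {m n} → Matrix m n → Matrix n m
(A ᵀ) i j = A j i

_⊕_ : ∀ {m n} → Matrix m n → Matrix m n → Matrix m n
(A ⊕ B) i j = A i j + B i j

_⊖_ : ∀ {m n} → Matrix m n → Matrix m n → Matrix m n
(A ⊖ B) i j = A i j - B i j

neg : ∀ {m n} → Matrix m n → Matrix m n
neg A i j = - A i j

_∙_ : ∀ {m n} → ℤ → Matrix m n → Matrix m n
(c ∙ A) i j = c * A i j

I : ∀ n → Matrix n n
I n i j with i ≟ j
... | yes _ = 1ℤ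
... | no  _ = 0ℤ

J : ∀ n → Matrix n n
J n i j = 1ℤ

-- Kronecker product; row/column index of A ⊗ B is (i , k) ↦ i * p + k
-- (row-major, via Data.Fin.remQuot).
_⊗_ : ∀ {m n p r} → Matrix m n → Matrix p r → Matrix (m *ℕ p) (n *ℕ r)
_⊗_ {m} {n} {p} {r} A B a b =
  A (quotient {m} p a) (quotient {n} r b) * B (remainder {m} p a) (remainder {n} r b)

IsPM : ∀ {m n} → Matrix m n → Set
IsPM A = ∀ i j → A i j ≡ 1ℤ ⊎ A i j ≡ -1ℤ

IsHadamard : ∀ n → Matrix n n → Set
IsHadamard n H = IsPM H × ((H · (H ᵀ)) ≐ ((+ n) ∙ I n))

IsSkewHadamard : ∀ n → Matrix n n → Set
IsSkewHadamard n H = IsHadamard n H × ((H ⊕ (H ᵀ)) ≐ ((+ 2) ∙ I n))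

IsAdjacency : ∀ n → Matrix n n → Set
IsAdjacency n A =
  (∀ i j → A i j ≡ 0ℤ ⊎ A i j ≡ 1ℤ) × (A ≐ (A ᵀ)) × (∀ i → A i i ≡ 0ℤ)

IsBalancedlySplittable : (n ℓ : ℕ) (a b : ℤ) → Matrix n n → Set
IsBalancedlySplittable n ℓ a b H =
  IsHadamard n H ×
  Σ (ℓ ≤ n) λ ℓ≤n →
  Σ (Permutation′ n) λ σ →
  Σ (Matrix n n) λ A →
    IsAdjacency n A ×
    (let H₁ : Matrix ℓ n
         H₁ = λ r j → H (σ ⟨$⟩ʳ inject≤ r ℓ≤n) j
     in ((H₁ ᵀ) · H₁) ≐
        ((((+ ℓ) ∙ I n) ⊕ (a ∙ A)) ⊕ (b ∙ ((J n ⊖ A) ⊖ I n))))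

blockH : ∀ q → Matrix q q → Matrix (suc q) (suc q)
blockH q Q zero    zero    = 1ℤ
blockH q Q zero    (suc j) = 1ℤ
blockH q Q (suc i) zero    = -1ℤ
blockH q Q (suc i) (suc j) = (I q ⊕ Q) i j

constructionM : ∀ q → Matrix q q → Matrix (suc q *ℕ q) (suc q *ℕ q)
constructionM q Q =
  neg (I (suc q) ⊗ J q) ⊕ ((blockH q Q ⊖ I (suc q)) ⊗ (I q ⊕ Q))

module Submission where

-- The first q rows of M form [-J P ... P];
--    their Gram matrix is computed blockwise, which exhibits the adjacency
--    matrix A = (J - I) ⊕ ((J - I) ⊗ I) of the splitting.

open import Defs
open import Data.Nat using (ℕ; zero; suc; _≤_) renaming (_*_ to _*ℕ_; _+_ to _+ℕ_)
import Data.Nat.Properties as ℕP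
open import Data.Integer using (ℤ; +_; -_; _+_; _-_; _*_; 0ℤ; 1ℤ; -1ℤ)
import Data.Integer.Properties as ℤP
open import Data.Integer.Tactic.RingSolver using (solve-∀)
open import Data.Fin using (Fin; zero; suc; _↑ˡ_; _↑ʳ_; combine; quotient; remainder; inject≤; _≟_)
import Data.Fin.Properties as FinP
import Data.Fin.Permutation as Perm
open import Data.Product using (_×_; _,_; proj₁; proj₂)
open import Data.Sum using (_⊎_; inj₁; inj₂)
open import Data.Empty using (⊥-elim)
open import Relation.Nullary using (yes; no)
open import Relation.Binary.PropositionalEquality hiding (J)
open ≡-Reasoning

Sign : ℤ → Set
Sign x = x ≡ 1ℤ ⊎ x ≡ -1ℤ

sign-* : ∀ {x y} → Sign x → Sign y → Sign (x * y)
sign-* (inj₁ refl) (inj₁ refl) = inj₁ refl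
sign-* (inj₁ refl) (inj₂ refl) = inj₂ refl
sign-* (inj₂ refl) (inj₁ refl) = inj₂ refl
sign-* (inj₂ refl) (inj₂ refl) = inj₁ refl

isolate : ∀ a s b → a + s ≡ b → s ≡ b - a
isolate a s b a+s≡b = trans (undo a s) (cong (_- a) a+s≡b)
  where
  undo : ∀ a s → s ≡ (a + s) - a
  undo = solve-∀

-- Finite sums

sum-cong : ∀ {n} {f g : Fin n → ℤ} → (∀ i → f i ≡ g i) → sumFin f ≡ sumFin g
sum-cong {zero}  f≗g = refl
sum-cong {suc n} f≗g = cong₂ _+_ (f≗g zero) (sum-cong (λ i → f≗g (suc i)))

sum-+ : ∀ {n} (f g : Fin n → ℤ) → sumFin (λ i → f i + g i) ≡ sumFin f + sumFin g
sum-+ {zero}  f g = refl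
sum-+ {suc n} f g =
  trans (cong (_+_ (f zero + g zero)) (sum-+ (λ i → f (suc i)) (λ i → g (suc i))))
        (interchange (f zero) (g zero) _ _)
  where
  interchange : ∀ a b c d → (a + b) + (c + d) ≡ (a + c) + (b + d)
  interchange = solve-∀

sum-*ˡ : ∀ {n} c (f : Fin n → ℤ) → sumFin (λ i → c * f i) ≡ c * sumFin f
sum-*ˡ {zero}  c f = sym (ℤP.*-zeroʳ c)
sum-*ˡ {suc n} c f =
  trans (cong (_+_ (c * f zero)) (sum-*ˡ c (λ i → f (suc i))))
        (sym (ℤP.*-distribˡ-+ c (f zero) _))

sum-*ʳ : ∀ {n} c (f : Fin n → ℤ) → sumFin (λ i → f i * c) ≡ sumFin f * c
sum-*ʳ c f = trans (sum-cong (λ i → ℤP.*-comm (f i) c))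
                   (trans (sum-*ˡ c f) (ℤP.*-comm c (sumFin f)))

sum-const : ∀ n c → sumFin {n} (λ _ → c) ≡ + n * c
sum-const zero    c = refl
sum-const (suc n) c = trans (cong (_+_ c) (sum-const n c)) (sym (ℤP.suc-* (+ n) c))

sum-↑ : ∀ n p (f : Fin (n +ℕ p) → ℤ) →
        sumFin f ≡ sumFin (λ j → f (j ↑ˡ p)) + sumFin (λ j → f (n ↑ʳ j))
sum-↑ zero    p f = sym (ℤP.+-identityˡ _)
sum-↑ (suc n) p f =
  trans (cong (_+_ (f zero)) (sum-↑ n p (λ i → f (suc i)))) (sym (ℤP.+-assoc (f zero) _ _))

sum-combine : ∀ m n (f : Fin (m *ℕ n) → ℤ) →
              sumFin f ≡ sumFin {m} (λ a → sumFin {n} (λ k → f (combine a k)))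
sum-combine zero    n f = refl
sum-combine (suc m) n f =
  trans (sum-↑ n (m *ℕ n) f)
        (cong (_+_ (sumFin (λ k → f (combine {suc m} {n} zero k))))
              (sum-combine m n (λ j → f (n ↑ʳ j))))

quotient-combine : ∀ {m} n (a : Fin m) (k : Fin n) → quotient n (combine a k) ≡ a
quotient-combine n a k = cong proj₁ (FinP.remQuot-combine a k)

remainder-combine : ∀ {m} n (a : Fin m) (k : Fin n) → remainder {m} n (combine a k) ≡ k
remainder-combine n a k = cong proj₂ (FinP.remQuot-combine a k)

I-cases : ∀ n (i j : Fin n) → (i ≡ j × I n i j ≡ 1ℤ) ⊎ (i ≢ j × I n i j ≡ 0ℤ)
I-cases n i j with i ≟ j
... | yes i≡j = inj₁ (i≡j , refl)
... | no  i≢j = inj₂ (i≢j , refl)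

I-diag : ∀ n (i : Fin n) → I n i i ≡ 1ℤ
I-diag n i with I-cases n i i
... | inj₁ (_ , e)   = e
... | inj₂ (i≢i , _) = ⊥-elim (i≢i refl)

I-off : ∀ n {i j : Fin n} → i ≢ j → I n i j ≡ 0ℤ
I-off n {i} {j} i≢j with I-cases n i j
... | inj₁ (i≡j , _) = ⊥-elim (i≢j i≡j)
... | inj₂ (_ , e)   = e

I-sym : ∀ n (i j : Fin n) → I n i j ≡ I n j i
I-sym n i j with I-cases n i j
... | inj₁ (refl , _) = refl
... | inj₂ (i≢j , e)  = trans e (sym (I-off n (λ j≡i → i≢j (sym j≡i))))

I-suc : ∀ n (i j : Fin n) → I (suc n) (suc i) (suc j) ≡ I n i j
I-suc n i j with I-cases n i j
... | inj₁ (refl , e) = trans (I-diag (suc n) (suc i)) (sym e)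
... | inj₂ (i≢j , e)  = trans (I-off (suc n) (λ eq → i≢j (FinP.suc-injective eq))) (sym e)

1-δ : ∀ {n} (i j : Fin n) → 1ℤ - I n i j ≡ 0ℤ ⊎ 1ℤ - I n i j ≡ 1ℤ
1-δ {n} i j with I-cases n i j
... | inj₁ (_ , δ≡1) = inj₁ (cong (_-_ 1ℤ) δ≡1)
... | inj₂ (_ , δ≡0) = inj₂ (cong (_-_ 1ℤ) δ≡0)

I-selects : ∀ n (i : Fin n) (f : Fin n → ℤ) → sumFin (λ j → I n i j * f j) ≡ f i
I-selects (suc n) zero f =
  trans (cong₂ _+_ (ℤP.*-identityˡ (f zero)) (sum-const n 0ℤ))
        (trans (cong (_+_ (f zero)) (ℤP.*-zeroʳ (+ n))) (ℤP.+-identityʳ (f zero)))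
I-selects (suc n) (suc i) f =
  trans (ℤP.+-identityˡ _)
        (trans (sum-cong (λ j → cong (_* f (suc j)) (I-suc n i j))) (I-selects n i (λ j → f (suc j))))

I-kron : ∀ m n (x y : Fin (m *ℕ n)) →
  I (m *ℕ n) x y ≡ I m (quotient n x) (quotient n y) * I n (remainder {m} n x) (remainder {m} n y)
I-kron m n x y with I-cases (m *ℕ n) x y | I-cases m (quotient n x) (quotient n y)
                  | I-cases n (remainder {m} n x) (remainder {m} n y)
... | inj₁ (refl , e) | inj₁ (_ , e₁) | inj₁ (_ , e₂) = trans e (sym (cong₂ _*_ e₁ e₂))
... | inj₁ (refl , _) | inj₂ (ne , _) | _             = ⊥-elim (ne refl)
... | inj₁ (refl , _) | inj₁ _        | inj₂ (ne , _) = ⊥-elim (ne refl)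
... | inj₂ (_ , e)    | inj₂ (_ , e₁) | _             =
  trans e (sym (cong (_* I n (remainder {m} n x) (remainder {m} n y)) e₁))
... | inj₂ (_ , e)    | inj₁ _        | inj₂ (_ , e₂) =
  trans e (sym (trans (cong (I m (quotient n x) (quotient n y) *_) e₂)
                      (ℤP.*-zeroʳ (I m (quotient n x) (quotient n y)))))
... | inj₂ (x≢y , _)  | inj₁ (q≡ , _) | inj₁ (r≡ , _) =
  ⊥-elim (x≢y (trans (sym (FinP.combine-remQuot {m} n x))
                     (trans (cong₂ combine q≡ r≡) (FinP.combine-remQuot {m} n y))))

-- Matrix algebra, entrywise

ᵀ-cong : ∀ {m n} {A B : Matrix m n} → A ≐ B → (A ᵀ) ≐ (B ᵀ)
ᵀ-cong A≐B i j = A≐B j i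

·-cong : ∀ {m n p} {A A' : Matrix m n} {B B' : Matrix n p} →
         A ≐ A' → B ≐ B' → (A · B) ≐ (A' · B')
·-cong A≐A' B≐B' i k = sum-cong (λ j → cong₂ _*_ (A≐A' i j) (B≐B' j k))

·-scaleˡ : ∀ {m n p} s (A : Matrix m n) (B : Matrix n p) i k → ((s ∙ A) · B) i k ≡ s * (A · B) i k
·-scaleˡ s A B i k = trans (sum-cong (λ j → ℤP.*-assoc s (A i j) (B j k))) (sum-*ˡ s (λ j → A i j * B j k))

·-scaleʳ : ∀ {m n p} s (A : Matrix m n) (B : Matrix n p) i k → (A · (s ∙ B)) i k ≡ s * (A · B) i k
·-scaleʳ s A B i k = trans (sum-cong (λ j → swap (A i j) (B j k))) (sum-*ˡ s (λ j → A i j * B j k))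
  where
  swap : ∀ a b → a * (s * b) ≡ s * (a * b)
  swap a b = trans (sym (ℤP.*-assoc a s b))
                   (trans (cong (_* b) (ℤP.*-comm a s)) (ℤP.*-assoc s a b))

I-·ˡ : ∀ {n p} (B : Matrix n p) i k → (I n · B) i k ≡ B i k
I-·ˡ {n} B i k = I-selects n i (λ j → B j k)

·-Iᵀ : ∀ {m n} (A : Matrix m n) i k → (A · (I n ᵀ)) i k ≡ A i k
·-Iᵀ {n = n} A i k =
  trans (sum-cong (λ j → ℤP.*-comm (A i j) (I n k j))) (I-selects n k (A i))

·ᵀ-⊕ : ∀ {m n p} (A B : Matrix m n) (C D : Matrix p n) i k →
       ((A ⊕ B) · ((C ⊕ D) ᵀ)) i k ≡
       (A · (C ᵀ)) i k + (A · (D ᵀ)) i k + (B · (C ᵀ)) i k + (B · (D ᵀ)) i k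
·ᵀ-⊕ A B C D i k = begin
    sumFin (λ j → (A i j + B i j) * (C k j + D k j))
  ≡⟨ sum-cong (λ j → expand (A i j) (B i j) (C k j) (D k j)) ⟩
    sumFin (λ j → a j + b j + c j + d j)
  ≡⟨ sum-+ (λ j → a j + b j + c j) d ⟩
    sumFin (λ j → a j + b j + c j) + sumFin d
  ≡⟨ cong (_+ sumFin d) (trans (sum-+ (λ j → a j + b j) c) (cong (_+ sumFin c) (sum-+ a b))) ⟩
    sumFin a + sumFin b + sumFin c + sumFin d
  ∎
  where
  a = λ j → A i j * C k j
  b = λ j → A i j * D k j
  c = λ j → B i j * C k j
  d = λ j → B i j * D k j
  expand : ∀ x y z w → (x + y) * (z + w) ≡ x * z + x * w + y * z + y * w
  expand = solve-∀

⊗-· : ∀ {m n p r s t} (A : Matrix m n) (B : Matrix p r) (C : Matrix n s) (D : Matrix r t) x y →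
      ((A ⊗ B) · (C ⊗ D)) x y ≡
      (A · C) (quotient p x) (quotient t y) * (B · D) (remainder {m} p x) (remainder {s} t y)
⊗-· {m} {n} {p} {r} {s} {t} A B C D x y = begin
    sumFin term
  ≡⟨ sum-combine n r term ⟩
    sumFin (λ c → sumFin (λ j → term (combine {n} {r} c j)))
  ≡⟨ sum-cong (λ c → sum-cong (regroup c)) ⟩
    sumFin (λ c → sumFin (λ j → (A a c * C c b) * (B k j * D j l)))
  ≡⟨ sum-cong (λ c → sum-*ˡ (A a c * C c b) (λ j → B k j * D j l)) ⟩
    sumFin (λ c → (A a c * C c b) * (B · D) k l)
  ≡⟨ sum-*ʳ ((B · D) k l) (λ c → A a c * C c b) ⟩
    (A · C) a b * (B · D) k l
  ∎
  where
  a = quotient p x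
  b = quotient t y
  k = remainder {m} p x
  l = remainder {s} t y
  term : Fin (n *ℕ r) → ℤ
  term z = (A a (quotient {n} r z) * B k (remainder {n} r z)) *
           (C (quotient {n} r z) b * D (remainder {n} r z) l)
  interchange : ∀ u v w z → (u * v) * (w * z) ≡ (u * w) * (v * z)
  interchange = solve-∀
  regroup : ∀ c j → term (combine c j) ≡ (A a c * C c b) * (B k j * D j l)
  regroup c j =
    trans (cong₂ (λ c' j' → (A a c' * B k j') * (C c' b * D j' l))
                 (quotient-combine r c j) (remainder-combine r c j))
          (interchange (A a c) (B k j) (C c b) (D j l))

·ᵀ-shift : ∀ {n} s (X : Matrix n n) i k →
           (((s ∙ I n) ⊕ X) · (((s ∙ I n) ⊕ X) ᵀ)) i k ≡
           s * s * I n i k + s * (X i k + X k i) + (X · (X ᵀ)) i k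
·ᵀ-shift {n} s X i k = begin
    (((s ∙ I n) ⊕ X) · (((s ∙ I n) ⊕ X) ᵀ)) i k
  ≡⟨ ·ᵀ-⊕ (s ∙ I n) X (s ∙ I n) X i k ⟩
    ((s ∙ I n) · ((s ∙ I n) ᵀ)) i k + ((s ∙ I n) · (X ᵀ)) i k
      + (X · ((s ∙ I n) ᵀ)) i k + (X · (X ᵀ)) i k
  ≡⟨ cong (_+ (X · (X ᵀ)) i k) (cong₂ _+_ (cong₂ _+_ II IX) XI) ⟩
    s * (s * I n i k) + s * X k i + s * X i k + (X · (X ᵀ)) i k
  ≡⟨ cong (_+ (X · (X ᵀ)) i k) (collect s (I n i k) (X i k) (X k i)) ⟩
    s * s * I n i k + s * (X i k + X k i) + (X · (X ᵀ)) i k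
  ∎
  where
  II : ((s ∙ I n) · ((s ∙ I n) ᵀ)) i k ≡ s * (s * I n i k)
  II = trans (·-scaleˡ s (I n) ((s ∙ I n) ᵀ) i k)
             (cong (s *_) (trans (I-·ˡ ((s ∙ I n) ᵀ) i k) (cong (s *_) (I-sym n k i))))
  IX : ((s ∙ I n) · (X ᵀ)) i k ≡ s * X k i
  IX = trans (·-scaleˡ s (I n) (X ᵀ) i k) (cong (s *_) (I-·ˡ (X ᵀ) i k))
  XI : (X · ((s ∙ I n) ᵀ)) i k ≡ s * X i k
  XI = trans (·-scaleʳ s X (I n ᵀ) i k) (cong (s *_) (·-Iᵀ X i k))
  collect : ∀ s δ x y → s * (s * δ) + s * y + s * x ≡ s * s * δ + s * (x + y)
  collect = solve-∀

-- Skew Hadamard matrices: the core C = H - I is skew with C Cᵀ = (n - 1) I.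

module SkewHadamardCore {m : ℕ} (H : Matrix (suc m) (suc m))
                        (skew : IsSkewHadamard (suc m) H) where

  private
    n = suc m

  C : Matrix n n
  C = H ⊖ I n

  -- A skew {1,-1}-matrix has ones on the diagonal: H a a + H a a = 2.
  diagonal-one : ∀ a → H a a ≡ 1ℤ
  diagonal-one a with proj₁ (proj₁ skew) a a | proj₂ skew a a
  ... | inj₁ Haa≡1  | _          = Haa≡1
  ... | inj₂ Haa≡-1 | Haa+Haa≡2I =
    ⊥-elim (impossible (trans (sym (cong₂ _+_ Haa≡-1 Haa≡-1))
                              (trans Haa+Haa≡2I (cong (+ 2 *_) (I-diag n a)))))
    where
    impossible : -1ℤ + -1ℤ ≢ + 2 * 1ℤ
    impossible ()

  C-diagonal : ∀ a → C a a ≡ 0ℤ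
  C-diagonal a = cong₂ _-_ (diagonal-one a) (I-diag n a)

  C-offdiagonal : ∀ a b → a ≢ b → Sign (C a b)
  C-offdiagonal a b a≢b rewrite I-off n a≢b | ℤP.+-identityʳ (H a b) = proj₁ (proj₁ skew) a b

  -- C + Cᵀ = (H + Hᵀ) - 2I = 0.
  C-skew : ∀ a b → C a b + C b a ≡ 0ℤ
  C-skew a b = begin
      (H a b - I n a b) + (H b a - I n b a)
    ≡⟨ cong (λ δ → (H a b - I n a b) + (H b a - δ)) (I-sym n b a) ⟩
      (H a b - I n a b) + (H b a - I n a b)
    ≡⟨ regroup (H a b) (H b a) (I n a b) ⟩
      (H a b + H b a) - + 2 * I n a b
    ≡⟨ cong (_- + 2 * I n a b) (proj₂ skew a b) ⟩
      + 2 * I n a b - + 2 * I n a b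
    ≡⟨ ℤP.+-inverseʳ (+ 2 * I n a b) ⟩
      0ℤ
    ∎
    where
    regroup : ∀ x y δ → (x - δ) + (y - δ) ≡ (x + y) - + 2 * δ
    regroup = solve-∀

  -- C Cᵀ = H Hᵀ - (H + Hᵀ) + I = (m + 1) I - 2 I + I.
  C-gram : (C · (C ᵀ)) ≐ ((+ m) ∙ I n)
  C-gram a b = begin
      (C · (C ᵀ)) a b
    ≡⟨ ·-cong C≐ (ᵀ-cong C≐) a b ⟩
      (((-1ℤ ∙ I n) ⊕ H) · (((-1ℤ ∙ I n) ⊕ H) ᵀ)) a b
    ≡⟨ ·ᵀ-shift -1ℤ H a b ⟩
      -1ℤ * -1ℤ * I n a b + -1ℤ * (H a b + H b a) + (H · (H ᵀ)) a b
    ≡⟨ cong₂ (λ s g → -1ℤ * -1ℤ * I n a b + -1ℤ * s + g) (proj₂ skew a b) (proj₂ (proj₁ skew) a b) ⟩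
      -1ℤ * -1ℤ * I n a b + -1ℤ * (+ 2 * I n a b) + + n * I n a b
    ≡⟨ simplify (+ m) (I n a b) ⟩
      + m * I n a b
    ∎
    where
    C≐ : C ≐ ((-1ℤ ∙ I n) ⊕ H)
    C≐ a b = trans (ℤP.+-comm (H a b) (- I n a b)) (cong (_+ H a b) (sym (ℤP.-1*i≡-i (I n a b))))
    simplify : ∀ m δ → -1ℤ * -1ℤ * δ + -1ℤ * (+ 2 * δ) + (1ℤ + m) * δ ≡ m * δ
    simplify = solve-∀

-- Matrices P with P + Pᵀ = 2I: transposing preserves unit row sums and
-- the Gram matrix, since Pᵀ = 2I - P.

module NearlySkew {n : ℕ} (P : Matrix n n) (P-skew : ∀ k l → P k l + P l k ≡ + 2 * I n k l) where

  transpose≐ : (P ᵀ) ≐ (((+ 2) ∙ I n) ⊕ (-1ℤ ∙ P))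
  transpose≐ k l = begin
      P l k
    ≡⟨ isolate (P k l) (P l k) (+ 2 * I n k l) (P-skew k l) ⟩
      + 2 * I n k l - P k l
    ≡⟨ cong (_+_ (+ 2 * I n k l)) (sym (ℤP.-1*i≡-i (P k l))) ⟩
      + 2 * I n k l + -1ℤ * P k l
    ∎

  column-sums : (∀ k → sumFin (P k) ≡ 1ℤ) → ∀ l → sumFin (λ r → P r l) ≡ 1ℤ
  column-sums row-sums l = begin
      sumFin (λ r → P r l)
    ≡⟨ sum-cong (transpose≐ l) ⟩
      sumFin (λ r → + 2 * I n l r + -1ℤ * P l r)
    ≡⟨ sum-+ (λ r → + 2 * I n l r) (λ r → -1ℤ * P l r) ⟩
      sumFin (λ r → + 2 * I n l r) + sumFin (λ r → -1ℤ * P l r)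
    ≡⟨ cong₂ _+_ (sum-*ˡ (+ 2) (I n l)) (sum-*ˡ -1ℤ (P l)) ⟩
      + 2 * sumFin (I n l) + -1ℤ * sumFin (P l)
    ≡⟨ cong₂ (λ s t → + 2 * s + -1ℤ * t) I-row-sum (row-sums l) ⟩
      1ℤ
    ∎
    where
    I-row-sum : sumFin (I n l) ≡ 1ℤ
    I-row-sum = trans (sum-cong (λ r → sym (ℤP.*-identityʳ (I n l r)))) (I-selects n l (λ _ → 1ℤ))

  -- Pᵀ P = (2I - P)(2I - P)ᵀ = 4I - 2(P + Pᵀ) + P Pᵀ = P Pᵀ.
  transpose-gram : ((P ᵀ) · P) ≐ (P · (P ᵀ))
  transpose-gram k l = begin
      ((P ᵀ) · ((P ᵀ) ᵀ)) k l
    ≡⟨ ·-cong transpose≐ (ᵀ-cong transpose≐) k l ⟩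
      ((((+ 2) ∙ I n) ⊕ (-1ℤ ∙ P)) · ((((+ 2) ∙ I n) ⊕ (-1ℤ ∙ P)) ᵀ)) k l
    ≡⟨ ·ᵀ-shift (+ 2) (-1ℤ ∙ P) k l ⟩
      + 2 * + 2 * I n k l + + 2 * (-1ℤ * P k l + -1ℤ * P l k) + ((-1ℤ ∙ P) · ((-1ℤ ∙ P) ᵀ)) k l
    ≡⟨ cong₂ (λ s g → + 2 * + 2 * I n k l + + 2 * s + g)
             (trans (sym (ℤP.*-distribˡ-+ -1ℤ (P k l) (P l k))) (cong (-1ℤ *_) (P-skew k l)))
             (trans (·-scaleˡ -1ℤ P ((-1ℤ ∙ P) ᵀ) k l) (cong (-1ℤ *_) (·-scaleʳ -1ℤ P (P ᵀ) k l))) ⟩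
      + 2 * + 2 * I n k l + + 2 * (-1ℤ * (+ 2 * I n k l)) + -1ℤ * (-1ℤ * (P · (P ᵀ)) k l)
    ≡⟨ cancel (I n k l) ((P · (P ᵀ)) k l) ⟩
      (P · (P ᵀ)) k l
    ∎
    where
    cancel : ∀ δ g → + 2 * + 2 * δ + + 2 * (-1ℤ * (+ 2 * δ)) + -1ℤ * (-1ℤ * g) ≡ g
    cancel = solve-∀

-- A skew Hadamard matrix (1 1ᵀ ; -1 P) with P = I + Q: comparing the rows
-- of H Hᵀ = (q+1) I and the entries of H + Hᵀ = 2I gives the facts on P.

module BlockForm {q : ℕ} (Q : Matrix q q) (skew : IsSkewHadamard (suc q) (blockH q Q)) where

  P : Matrix q q
  P = I q ⊕ Q

  -- P is the lower-right block of H.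
  P-sign : IsPM P
  P-sign k l = proj₁ (proj₁ skew) (suc k) (suc l)

  -- Row 0 is orthogonal to row k + 1: -1 + Σ P k m = 0.
  P-row-sums : ∀ k → sumFin (P k) ≡ 1ℤ
  P-row-sums k =
    trans (sum-cong (λ m → sym (ℤP.*-identityˡ (P k m))))
          (trans (isolate -1ℤ _ _ (proj₂ (proj₁ skew) zero (suc k)))
                 (cong (_- -1ℤ) (ℤP.*-zeroʳ (+ suc q))))

  -- Rows k + 1 and l + 1: 1 + Σ P k m P l m = (q+1) δ.
  P-gram : ∀ k l → (P · (P ᵀ)) k l ≡ + suc q * I q k l - 1ℤ
  P-gram k l = trans (isolate 1ℤ _ _ (proj₂ (proj₁ skew) (suc k) (suc l)))
                     (cong (λ δ → + suc q * δ - 1ℤ) (I-suc q k l))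

  -- The lower-right block of H + Hᵀ = 2I.
  P-skew : ∀ k l → P k l + P l k ≡ + 2 * I q k l
  P-skew k l = trans (proj₂ skew (suc k) (suc l)) (cong (+ 2 *_) (I-suc q k l))

-- The Kronecker construction M = -I ⊗ J + C ⊗ P

-- constructionM q Q is kroneckerM (H - I) (I + Q).
kroneckerM : ∀ {n q} → Matrix n n → Matrix q q → Matrix (n *ℕ q) (n *ℕ q)
kroneckerM {n} {q} C P = neg (I n ⊗ J q) ⊕ (C ⊗ P)

module KroneckerConstruction {n q : ℕ} (C : Matrix n n) (P : Matrix q q) where

  M : Matrix (n *ℕ q) (n *ℕ q)
  M = kroneckerM C P

  -- Diagonal blocks of M are -J, off-diagonal blocks are C a c P.
  M-sign : (∀ a → C a a ≡ 0ℤ) → (∀ a c → a ≢ c → Sign (C a c)) → IsPM P → IsPM M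
  M-sign C-diagonal C-offdiagonal P-sign x z =
    entry-sign (quotient q x) (quotient q z) (remainder {n} q x) (remainder {n} q z)
    where
    entry-sign : ∀ a c k m → Sign (- (I n a c * 1ℤ) + C a c * P k m)
    entry-sign a c k m with I-cases n a c
    ... | inj₁ (refl , δ≡1) =
      inj₂ (trans (cong₂ (λ δ γ → - (δ * 1ℤ) + γ * P k m) δ≡1 (C-diagonal a))
                  (cong (_+_ -1ℤ) (ℤP.*-zeroˡ (P k m))))
    ... | inj₂ (a≢c , δ≡0) rewrite δ≡0 =
      subst Sign (sym (ℤP.+-identityˡ (C a c * P k m))) (sign-* (C-offdiagonal a c a≢c) (P-sign k m))

  -- M Mᵀ = (I ⊗ J J) - (Cᵀ ⊗ J Pᵀ) - (C ⊗ P Jᵀ) + (C Cᵀ ⊗ P Pᵀ)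
  --      = q I ⊗ J - (C + Cᵀ) ⊗ J + q I ⊗ ((q+1) I - J) = q (q+1) I.
  M-gram : (∀ a b → C a b + C b a ≡ 0ℤ) → (C · (C ᵀ)) ≐ ((+ q) ∙ I n) →
           (∀ k → sumFin (P k) ≡ 1ℤ) → (∀ k l → (P · (P ᵀ)) k l ≡ + suc q * I q k l - 1ℤ) →
           (M · (M ᵀ)) ≐ ((+ suc q * + q) ∙ I (n *ℕ q))
  M-gram C-skew C-gram P-row-sums P-gram x y = begin
      (M · (M ᵀ)) x y
    ≡⟨ ·-cong M≐ (ᵀ-cong M≐) x y ⟩
      ((N ⊕ K) · ((N ⊕ K) ᵀ)) x y
    ≡⟨ ·ᵀ-⊕ N K N K x y ⟩
      (N · (N ᵀ)) x y + (N · (K ᵀ)) x y + (K · (N ᵀ)) x y + (K · (K ᵀ)) x y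
    ≡⟨ cong₂ _+_ (cong₂ _+_ (cong₂ _+_ NN NK) KN) KK ⟩
      (-1ℤ * (-1ℤ * I n b a)) * (+ q * 1ℤ) + (-1ℤ * C b a) * 1ℤ + (-1ℤ * C a b) * 1ℤ
        + (+ q * I n a b) * (+ suc q * I q k l - 1ℤ)
    ≡⟨ cong₂ (λ δ γ → (-1ℤ * (-1ℤ * δ)) * (+ q * 1ℤ) + (-1ℤ * γ) * 1ℤ + (-1ℤ * C a b) * 1ℤ
                        + (+ q * I n a b) * (+ suc q * I q k l - 1ℤ))
             (I-sym n b a) (isolate (C a b) (C b a) 0ℤ (C-skew a b)) ⟩
      (-1ℤ * (-1ℤ * I n a b)) * (+ q * 1ℤ) + (-1ℤ * (0ℤ - C a b)) * 1ℤ + (-1ℤ * C a b) * 1ℤ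
        + (+ q * I n a b) * (+ suc q * I q k l - 1ℤ)
    ≡⟨ simplify (+ q) (I n a b) (I q k l) (C a b) ⟩
      (+ suc q * + q) * (I n a b * I q k l)
    ≡⟨ cong (+ suc q * + q *_) (sym (I-kron n q x y)) ⟩
      (+ suc q * + q) * I (n *ℕ q) x y
    ∎
    where
    a = quotient q x
    b = quotient q y
    k = remainder {n} q x
    l = remainder {n} q y
    N K : Matrix (n *ℕ q) (n *ℕ q)
    N = (-1ℤ ∙ I n) ⊗ J q
    K = C ⊗ P
    M≐ : M ≐ (N ⊕ K)
    M≐ x z = cong (_+ K x z) (trans (ℤP.neg-distribˡ-* δ 1ℤ) (cong (_* 1ℤ) (sym (ℤP.-1*i≡-i δ))))
      where δ = I n (quotient q x) (quotient q z)
    NN : (N · (N ᵀ)) x y ≡ (-1ℤ * (-1ℤ * I n b a)) * (+ q * 1ℤ)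
    NN = trans (⊗-· (-1ℤ ∙ I n) (J q) ((-1ℤ ∙ I n) ᵀ) (J q ᵀ) x y)
               (cong₂ _*_ (trans (·-scaleˡ -1ℤ (I n) ((-1ℤ ∙ I n) ᵀ) a b)
                                 (cong (-1ℤ *_) (I-·ˡ ((-1ℤ ∙ I n) ᵀ) a b)))
                          (sum-const q 1ℤ))
    NK : (N · (K ᵀ)) x y ≡ (-1ℤ * C b a) * 1ℤ
    NK = trans (⊗-· (-1ℤ ∙ I n) (J q) (C ᵀ) (P ᵀ) x y)
               (cong₂ _*_ (trans (·-scaleˡ -1ℤ (I n) (C ᵀ) a b) (cong (-1ℤ *_) (I-·ˡ (C ᵀ) a b)))
                          (trans (sum-cong (λ m → ℤP.*-identityˡ (P l m))) (P-row-sums l)))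
    KN : (K · (N ᵀ)) x y ≡ (-1ℤ * C a b) * 1ℤ
    KN = trans (⊗-· C P ((-1ℤ ∙ I n) ᵀ) (J q ᵀ) x y)
               (cong₂ _*_ (trans (·-scaleʳ -1ℤ C (I n ᵀ) a b) (cong (-1ℤ *_) (·-Iᵀ C a b)))
                          (trans (sum-cong (λ m → ℤP.*-identityʳ (P k m))) (P-row-sums k)))
    KK : (K · (K ᵀ)) x y ≡ (+ q * I n a b) * (+ suc q * I q k l - 1ℤ)
    KK = trans (⊗-· C P (C ᵀ) (P ᵀ) x y) (cong₂ _*_ (C-gram a b) (P-gram k l))
    simplify : ∀ q' δ δ' c →
      (-1ℤ * (-1ℤ * δ)) * (q' * 1ℤ) + (-1ℤ * (0ℤ - c)) * 1ℤ + (-1ℤ * c) * 1ℤ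
        + (q' * δ) * ((1ℤ + q') * δ' - 1ℤ) ≡ ((1ℤ + q') * q') * (δ * δ')
    simplify = solve-∀

-- The first q rows of M, for C of order p + 1 whose first row is (0 1 ... 1)

module FirstBlockRows {p q : ℕ} (C : Matrix (suc p) (suc p)) (P : Matrix q q) where

  open KroneckerConstruction C P using (M)

  private
    N = suc p *ℕ q

  q≤N : q ≤ N
  q≤N = ℕP.m≤m+n q (p *ℕ q)

  H₁ : Matrix q N
  H₁ r z = M (inject≤ r q≤N) z

  blockAdjacency : Fin (suc p) → Fin (suc p) → Fin q → Fin q → ℤ
  blockAdjacency zero    zero    k l = 1ℤ - I q k l
  blockAdjacency zero    (suc b) k l = 0ℤ
  blockAdjacency (suc a) zero    k l = 0ℤ
  blockAdjacency (suc a) (suc b) k l = (1ℤ - I p a b) * I q k l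

  A : Matrix N N
  A x y = blockAdjacency (quotient q x) (quotient q y) (remainder {suc p} q x) (remainder {suc p} q y)

  blockAdjacency-01 : ∀ a b k l → blockAdjacency a b k l ≡ 0ℤ ⊎ blockAdjacency a b k l ≡ 1ℤ
  blockAdjacency-01 zero    zero    k l = 1-δ k l
  blockAdjacency-01 zero    (suc b) k l = inj₁ refl
  blockAdjacency-01 (suc a) zero    k l = inj₁ refl
  blockAdjacency-01 (suc a) (suc b) k l with 1-δ a b | I-cases q k l
  ... | inj₁ e | _              = inj₁ (cong (_* I q k l) e)
  ... | inj₂ e | inj₁ (_ , δ≡1) = inj₂ (cong₂ _*_ e δ≡1)
  ... | inj₂ e | inj₂ (_ , δ≡0) = inj₁ (cong₂ _*_ e δ≡0)

  blockAdjacency-sym : ∀ a b k l → blockAdjacency a b k l ≡ blockAdjacency b a l k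
  blockAdjacency-sym zero    zero    k l = cong (_-_ 1ℤ) (I-sym q k l)
  blockAdjacency-sym zero    (suc b) k l = refl
  blockAdjacency-sym (suc a) zero    k l = refl
  blockAdjacency-sym (suc a) (suc b) k l =
    cong₂ (λ δ δ' → (1ℤ - δ) * δ') (I-sym p a b) (I-sym q k l)

  blockAdjacency-diag : ∀ a k → blockAdjacency a a k k ≡ 0ℤ
  blockAdjacency-diag zero    k = cong (_-_ 1ℤ) (I-diag q k)
  blockAdjacency-diag (suc a) k = cong (λ δ → (1ℤ - δ) * I q k k) (I-diag p a)

  A-adjacency : IsAdjacency N A
  A-adjacency =
    (λ x y → blockAdjacency-01 (quotient q x) (quotient q y) (remainder {suc p} q x) (remainder {suc p} q y)) ,
    (λ x y → blockAdjacency-sym (quotient q x) (quotient q y) (remainder {suc p} q x) (remainder {suc p} q y)) ,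
    (λ x → blockAdjacency-diag (quotient q x) (remainder {suc p} q x))

  firstRow : Fin (suc p) → Fin q → Fin q → ℤ
  firstRow zero    r m = -1ℤ
  firstRow (suc c) r m = P r m

  H₁-entry : C zero zero ≡ 0ℤ → (∀ c → C zero (suc c) ≡ 1ℤ) →
             ∀ r z → H₁ r z ≡ firstRow (quotient q z) r (remainder {suc p} q z)
  H₁-entry C₀₀ C₀ₛ r z = begin
      M (inject≤ r q≤N) z
    ≡⟨ cong (λ x → M x z) row-index ⟩
      M (combine {suc p} zero r) z
    ≡⟨ cong₂ (λ a k → - (I (suc p) a c * 1ℤ) + C a c * P k m)
             (quotient-combine q zero r) (remainder-combine q zero r) ⟩
      - (I (suc p) zero c * 1ℤ) + C zero c * P r m
    ≡⟨ entry c ⟩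
      firstRow c r m
    ∎
    where
    c = quotient q z
    m = remainder {suc p} q z
    row-index : inject≤ r q≤N ≡ combine {suc p} {q} zero r
    row-index = FinP.toℕ-injective (trans (FinP.toℕ-inject≤ r q≤N) (sym (FinP.toℕ-↑ˡ r (p *ℕ q))))
    entry : ∀ c → - (I (suc p) zero c * 1ℤ) + C zero c * P r m ≡ firstRow c r m
    entry zero    = cong (λ γ → -1ℤ + γ * P r m) C₀₀
    entry (suc c) = trans (ℤP.+-identityˡ _)
                          (trans (cong (_* P r m) (C₀ₛ c)) (ℤP.*-identityˡ (P r m)))

  private
    -- value of an off-diagonal block entry involving block 0
    edge : ∀ q' δ → -1ℤ * 1ℤ ≡ (1ℤ + q') * (0ℤ * δ + 0ℤ) - 1ℤ
    edge = solve-∀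

  -- Blockwise Gram matrix of H₁: J J = q J, -J P = -J and Pᵀ P = (q+1) I - J.
  block-gram : (∀ m → sumFin (λ r → P r m) ≡ 1ℤ) → (∀ k l → ((P ᵀ) · P) k l ≡ + suc q * I q k l - 1ℤ) →
               ∀ a b k l → sumFin (λ r → firstRow a r k * firstRow b r l)
                           ≡ + suc q * (I (suc p) a b * I q k l + blockAdjacency a b k l) - 1ℤ
  block-gram column-sums PᵀP zero zero k l =
    trans (sum-const q 1ℤ) (corner (+ q) (I q k l))
    where
    corner : ∀ q' δ → q' * 1ℤ ≡ (1ℤ + q') * (1ℤ * δ + (1ℤ - δ)) - 1ℤ
    corner = solve-∀
  block-gram column-sums PᵀP zero (suc b) k l =
    trans (sum-*ˡ -1ℤ (λ r → P r l)) (trans (cong (-1ℤ *_) (column-sums l)) (edge (+ q) (I q k l)))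
  block-gram column-sums PᵀP (suc a) zero k l =
    trans (sum-*ʳ -1ℤ (λ r → P r k)) (trans (cong (_* -1ℤ) (column-sums k)) (edge (+ q) (I q k l)))
  block-gram column-sums PᵀP (suc a) (suc b) k l =
    trans (PᵀP k l) (trans (inner (+ q) (I p a b) (I q k l))
                           (cong (λ δ → + suc q * (δ * I q k l + (1ℤ - I p a b) * I q k l) - 1ℤ)
                                 (sym (I-suc p a b))))
    where
    inner : ∀ q' δ δ' → (1ℤ + q') * δ' - 1ℤ ≡ (1ℤ + q') * (δ * δ' + (1ℤ - δ) * δ') - 1ℤ
    inner = solve-∀

  -- H₁ᵀ H₁ = (q+1)(I + A) - J, i.e. parameters (N, q, q, -1).
  H₁-gram : C zero zero ≡ 0ℤ → (∀ c → C zero (suc c) ≡ 1ℤ) →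
            (∀ m → sumFin (λ r → P r m) ≡ 1ℤ) → (∀ k l → ((P ᵀ) · P) k l ≡ + suc q * I q k l - 1ℤ) →
            ((H₁ ᵀ) · H₁) ≐ ((((+ q) ∙ I N) ⊕ ((+ q) ∙ A)) ⊕ (-1ℤ ∙ ((J N ⊖ A) ⊖ I N)))
  H₁-gram C₀₀ C₀ₛ column-sums PᵀP x y = begin
      sumFin (λ r → H₁ r x * H₁ r y)
    ≡⟨ sum-cong (λ r → cong₂ _*_ (H₁-entry C₀₀ C₀ₛ r x) (H₁-entry C₀₀ C₀ₛ r y)) ⟩
      sumFin (λ r → firstRow a r k * firstRow b r l)
    ≡⟨ block-gram column-sums PᵀP a b k l ⟩
      + suc q * (I (suc p) a b * I q k l + A x y) - 1ℤ
    ≡⟨ cong (λ δ → + suc q * (δ + A x y) - 1ℤ) (sym (I-kron (suc p) q x y)) ⟩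
      + suc q * (I N x y + A x y) - 1ℤ
    ≡⟨ split-form (+ q) (I N x y) (A x y) ⟩
      + q * I N x y + + q * A x y + -1ℤ * ((1ℤ - A x y) - I N x y)
    ∎
    where
    a = quotient q x
    b = quotient q y
    k = remainder {suc p} q x
    l = remainder {suc p} q y
    split-form : ∀ q' δ α → (1ℤ + q') * (δ + α) - 1ℤ ≡ q' * δ + q' * α + -1ℤ * ((1ℤ - α) - δ)
    split-form = solve-∀

theorem3p8 : (q : ℕ) → 1 ≤ q → (Q : Matrix q q) →
    IsSkewHadamard (suc q) (blockH q Q) →
    IsBalancedlySplittable (suc q *ℕ q) q (+ q) -1ℤ (constructionM q Q)
theorem3p8 q _ Q skew =
  -- M is Hadamard; its first q rows (σ = id) split it with adjacency A.
  -- The first row of C = H - I is (0 1 ... 1) by the block form of H.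
  (M-sign C-diagonal C-offdiagonal P-sign , M-hadamard) ,
  q≤N , Perm.id , A , A-adjacency ,
  H₁-gram (C-diagonal zero) (λ _ → refl) (column-sums P-row-sums) PᵀP-gram
  where
  open SkewHadamardCore (blockH q Q) skew
  open BlockForm Q skew
  open NearlySkew P P-skew
  open KroneckerConstruction C P
  open FirstBlockRows C P

  M-hadamard : (M · (M ᵀ)) ≐ ((+ (suc q *ℕ q)) ∙ I (suc q *ℕ q))
  M-hadamard x y = trans (M-gram C-skew C-gram P-row-sums P-gram x y)
                         (cong (_* I (suc q *ℕ q) x y) (sym (ℤP.pos-* (suc q) q)))

  PᵀP-gram : ∀ k l → ((P ᵀ) · P) k l ≡ + suc q * I q k l - 1ℤ
  PᵀP-gram k l = trans (transpose-gram k l) (P-gram k l)
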